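{- The worst-case merge cost of the Shivers sort on inputs of length $n$ composed of $m$ original runs is $\omega(n\log m)$: for every $c>0$ there are inputs with arbitrarily large values of $n$ and $m$ on which the merge cost of the Shivers sort exceeds $c\cdot n\log m$.
   Context: Model: an input is identified with its sequence $\langle n_1,\dots,n_m\rangle$ of positive integer run lengths; $n=\sum_i n_i$ is the input length, $m$ the number of original runs. The algorithm maintains a stack $Q_1,\dots,Q_\ell$ of runs (represented by their lengths), top $Q_\ell$; $Y,Z$ denote $Q_{\ell-1},Q_\ell$ when they exist, and any test involving a nonexistent stack element evaluates to false. "Push" removes the next original run (left to right) and pushes it. "Merge $Y$ and $Z$" replaces the top two runs by one run of length $|Y|+|Z|$. A merge of runs $A,B$ costs $|A|+|B|$; the merge cost is the total cost of all merges performed. $\log$ is base 2. Shivers sort: while original runs remain: push the next run, then while $2^{\lfloor \log |Y|\rfloor}\le |Z|$, merge $Y$ and $Z$. After all runs are pushed, repeatedly merge $Y$ and $Z$ until one run remains.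
   Formalization: The constant c ranges over the positive rationals. -}

module Defs where

open import Data.Nat using (ℕ; zero; suc; _+_; _*_; _^_; _≤_; _<_; _≤?_)
open import Data.Nat.Logarithm using (⌊log₂_⌋)
open import Data.List using (List; []; _∷_)
open import Data.Product using (_×_; _,_; proj₁; proj₂)
open import Relation.Nullary using (yes; no)

-- A stack of runs is a list of run lengths with the TOP element first.

-- Inner merge loop of Shivers sort.  `collapse z s` : Z = z is the top run,
-- s is the rest of the stack (head of s is Y).
collapse : ℕ → List ℕ → ℕ × List ℕ
collapse z [] = 0 , z ∷ []
collapse z (y ∷ s) with 2 ^ ⌊log₂ y ⌋ ≤? z
... | yes _ = let r = collapse (y + z) s in (y + z) + proj₁ r , proj₂ r
... | no  _ = 0 , z ∷ y ∷ s

mergeAll : ℕ → List ℕ → ℕ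
mergeAll z [] = 0
mergeAll z (y ∷ s) = (y + z) + mergeAll (y + z) s

finalCost : List ℕ → ℕ
finalCost [] = 0
finalCost (z ∷ s) = mergeAll z s

shiversRun : List ℕ → List ℕ → ℕ
shiversRun st [] = finalCost st
shiversRun st (r ∷ rs) = let c = collapse r st in proj₁ c + shiversRun (proj₂ c) rs

shiversCost : List ℕ → ℕ
shiversCost runs = shiversRun [] runs

module Submission where

open import Defs
open import Data.Nat using (ℕ; _+_; _*_; _^_; _≤_; _<_)
open import Data.List using (List; length)
open import Data.Nat.ListAction using (sum)
open import Data.List.Relation.Unary.All using (All)
open import Data.Product using (Σ; _×_)

open import Data.Nat using (zero; suc; z≤n; s≤s; _≤?_; NonZero; >-nonZero)
open import Data.Nat.Properties
open import Data.Nat.Logarithm using (⌊log₂_⌋; ⌊log₂[2^n]⌋≡n)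
open import Data.List using ([]; _∷_; _++_; applyDownFrom)
open import Data.List.Properties using (length-++; length-applyDownFrom)
open import Data.Nat.ListAction.Properties using (sum-++)
open import Data.List.Relation.Unary.All using ([]; _∷_)
open import Data.List.Relation.Unary.All.Properties using (++⁺; applyDownFrom⁺₂)
open import Data.Product using (∃₂; _,_; proj₁)
open import Relation.Nullary using (yes; no)
open import Relation.Nullary.Negation using (contradiction)
open import Relation.Binary.PropositionalEquality using (_≡_; refl; sym; cong; subst; module ≡-Reasoning)
open import Data.Nat.Solver using (module +-*-Solver)
open +-*-Solver using (solve; _:+_; _:*_; _:=_; con)

-- On the input ⟨2^k, …, 2, 1, 2^(k+1)⟩ no merge happens until the last run is
-- pushed, since 2^j < 2^⌊log 2^(j+1)⌋.  The last run then absorbs the k+1 runs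
-- of the stack one by one, each merge costing at least 2^(k+1) ≥ n/2.  So the
-- cost is about n·m/2, which beats c·n·log m once m is large.

n<2^n : ∀ n → n < 2 ^ n
n<2^n zero    = s≤s z≤n
n<2^n (suc n) = +-mono-≤ (m^n>0 2 n) (subst (suc n ≤_) (sym (+-identityʳ (2 ^ n))) (n<2^n n))

2+n≤4n : ∀ n → 0 < n → 2 + n ≤ 2 * (2 * n)
2+n≤4n (suc n) _ = begin
  3 + n                ≤⟨ +-mono-≤ (n≤1+n 3) (m≤m*n n 4) ⟩
  4 + n * 4            ≡⟨ solve 1 (λ x → con 4 :+ x :* con 4 := con 2 :* (con 2 :* (con 1 :+ x))) refl n ⟩
  2 * (2 * suc n)      ∎
  where open ≤-Reasoning

-- Read with m = k + 2: e bounds log₂ m, and (k+1)/2 exceeds p·e, the slope c·log m.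
linear-beats-log : ∀ p N → ∃₂ λ k e → N ≤ k × 2 + k ≤ 2 ^ e × e * p * 2 ≤ suc k
linear-beats-log p N = k , 2 + (a + a) , N≤k , 2+n≤4n k (m^n>0 2 (a + a)) , e*p*2≤1+k
  where
  open ≤-Reasoning
  a = 4 * p + N
  k = 2 ^ (a + a)
  a<k : a < k
  a<k = <-≤-trans (n<2^n a) (^-monoʳ-≤ 2 (m≤m+n a a))
  N≤k : N ≤ k
  N≤k = ≤-trans (m≤n+m N (4 * p)) (<⇒≤ a<k)
  e*p*2≤1+k : (2 + (a + a)) * p * 2 ≤ suc k
  e*p*2≤1+k = begin
    (2 + (a + a)) * p * 2 ≡⟨ solve 2 (λ x y → (con 2 :+ (x :+ x)) :* y :* con 2 := (con 1 :+ x) :* (con 4 :* y))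
                               refl a p ⟩
    suc a * (4 * p)       ≤⟨ *-monoʳ-≤ (suc a) (m≤m+n (4 * p) N) ⟩
    suc a * a             ≤⟨ *-monoʳ-≤ (suc a) (n≤1+n a) ⟩
    suc a * suc a         ≤⟨ *-mono-≤ (n<2^n a) (n<2^n a) ⟩
    2 ^ a * 2 ^ a         ≡⟨ sym (^-distribˡ-+-* 2 a a) ⟩
    k                     ≤⟨ n≤1+n k ⟩
    suc k                 ∎

length≤sum : ∀ {xs : List ℕ} → All (0 <_) xs → length xs ≤ sum xs
length≤sum []           = z≤n
length≤sum (x>0 ∷ xs>0) = +-mono-≤ x>0 (length≤sum xs>0)

MergesUnder : ℕ → ℕ → Set
MergesUnder z y = 2 ^ ⌊log₂ y ⌋ ≤ z

mergesUnder-2^ : ∀ {z} j → 2 ^ j ≤ z → MergesUnder z (2 ^ j)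
mergesUnder-2^ {z} j 2^j≤z = subst (λ i → 2 ^ i ≤ z) (sym (⌊log₂[2^n]⌋≡n j)) 2^j≤z

collapse-stops : ∀ z y s → z < 2 ^ ⌊log₂ y ⌋ → collapse z (y ∷ s) ≡ (0 , z ∷ y ∷ s)
collapse-stops z y s z<bound with 2 ^ ⌊log₂ y ⌋ ≤? z
... | yes bound≤z = contradiction bound≤z (<⇒≱ z<bound)
... | no  _       = refl

collapse-cost-≥ : ∀ {Z} z s → Z ≤ z → All (MergesUnder Z) s → length s * Z ≤ proj₁ (collapse z s)
collapse-cost-≥ z []      _   _           = z≤n
collapse-cost-≥ z (y ∷ s) Z≤z (y↓Z ∷ s↓Z) with 2 ^ ⌊log₂ y ⌋ ≤? z
... | yes _  = +-mono-≤ Z≤y+z (collapse-cost-≥ (y + z) s Z≤y+z s↓Z)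
  where Z≤y+z = ≤-trans Z≤z (m≤n+m z y)
... | no y↑z = contradiction (≤-trans y↓Z Z≤z) y↑z

collapse-power-stops : ∀ j s → collapse (2 ^ j) (2 ^ suc j ∷ s) ≡ (0 , 2 ^ j ∷ 2 ^ suc j ∷ s)
collapse-power-stops j s = collapse-stops (2 ^ j) (2 ^ suc j) s
  (subst (λ i → 2 ^ j < 2 ^ i) (sym (⌊log₂[2^n]⌋≡n (suc j))) (^-monoʳ-< 2 (s≤s (s≤s z≤n)) (n<1+n j)))

push-powers-cost-≥ : ∀ {Z} j s → 2 ^ j ≤ Z → All (MergesUnder Z) s →
  (suc j + length s) * Z ≤ shiversRun (2 ^ j ∷ s) (applyDownFrom (2 ^_) j ++ Z ∷ [])
push-powers-cost-≥ zero s 1≤Z s↓Z =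
  ≤-trans (collapse-cost-≥ _ (1 ∷ s) ≤-refl (mergesUnder-2^ 0 1≤Z ∷ s↓Z)) (m≤m+n _ _)
push-powers-cost-≥ {Z} (suc j) s 2^[1+j]≤Z s↓Z rewrite collapse-power-stops j s =
  ≤-trans (≤-reflexive (cong (_* Z) (sym (+-suc (suc j) (length s)))))
    (push-powers-cost-≥ j (2 ^ suc j ∷ s) (≤-trans (^-monoʳ-≤ 2 (n≤1+n j)) 2^[1+j]≤Z)
      (mergesUnder-2^ (suc j) 2^[1+j]≤Z ∷ s↓Z))

hardInput : ℕ → List ℕ
hardInput k = applyDownFrom (2 ^_) (suc k) ++ 2 ^ suc k ∷ []

hardInput-positive : ∀ k → All (0 <_) (hardInput k)
hardInput-positive k = ++⁺ (applyDownFrom⁺₂ (2 ^_) (suc k) (m^n>0 2)) (m^n>0 2 (suc k) ∷ [])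

length-hardInput : ∀ k → length (hardInput k) ≡ 2 + k
length-hardInput k = begin
  length (hardInput k)                      ≡⟨ length-++ (applyDownFrom (2 ^_) (suc k)) ⟩
  length (applyDownFrom (2 ^_) (suc k)) + 1 ≡⟨ cong (_+ 1) (length-applyDownFrom (2 ^_) (suc k)) ⟩
  suc k + 1                                 ≡⟨ +-comm (suc k) 1 ⟩
  2 + k                                     ∎
  where open ≡-Reasoning

sum-powers : ∀ j → suc (sum (applyDownFrom (2 ^_) j)) ≡ 2 ^ j
sum-powers zero    = refl
sum-powers (suc j) = begin
  suc (2 ^ j + sum (applyDownFrom (2 ^_) j)) ≡⟨ sym (+-suc (2 ^ j) _) ⟩
  2 ^ j + suc (sum (applyDownFrom (2 ^_) j)) ≡⟨ cong (2 ^ j +_) (sum-powers j) ⟩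
  2 ^ j + 2 ^ j                              ≡⟨ cong (2 ^ j +_) (sym (+-identityʳ (2 ^ j))) ⟩
  2 ^ suc j                                  ∎
  where open ≡-Reasoning

sum-hardInput : ∀ k → suc (sum (hardInput k)) ≡ 2 ^ (2 + k)
sum-hardInput k = begin
  suc (sum (hardInput k))            ≡⟨ cong suc (sum-++ (applyDownFrom (2 ^_) (suc k)) (2 ^ suc k ∷ [])) ⟩
  suc (sum powers) + (2 ^ suc k + 0) ≡⟨ cong (_+ (2 ^ suc k + 0)) (sum-powers (suc k)) ⟩
  2 ^ (2 + k)                        ∎
  where open ≡-Reasoning
        powers = applyDownFrom (2 ^_) (suc k)

shiversCost-hardInput : ∀ k → suc k * 2 ^ suc k ≤ shiversCost (hardInput k)
shiversCost-hardInput k =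
  ≤-trans (≤-reflexive (cong (_* 2 ^ suc k) (sym (+-identityʳ (suc k)))))
    (push-powers-cost-≥ k [] (^-monoʳ-≤ 2 (n≤1+n k)) [])

hardInput-cost-beats-log : ∀ p q .{{_ : NonZero p}} .{{_ : NonZero q}} k e →
  2 + k ≤ 2 ^ e → e * p * 2 ≤ suc k →
  length (hardInput k) ^ (p * sum (hardInput k)) < 2 ^ (q * shiversCost (hardInput k))
hardInput-cost-beats-log p q k zero (s≤s ()) _
hardInput-cost-beats-log p q k e@(suc _) 2+k≤2^e 2ep≤1+k = begin-strict
  m ^ (p * n)        ≤⟨ ^-monoˡ-≤ (p * n) (≤-trans (≤-reflexive (length-hardInput k)) 2+k≤2^e) ⟩
  (2 ^ e) ^ (p * n)  ≡⟨ ^-*-assoc 2 e (p * n) ⟩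
  2 ^ (e * (p * n))  <⟨ ^-monoʳ-< 2 (s≤s (s≤s z≤n)) exponent< ⟩
  2 ^ (q * cost)     ∎
  where
  open ≤-Reasoning
  m = length (hardInput k)
  n = sum (hardInput k)
  cost = shiversCost (hardInput k)
  exponent< : e * (p * n) < q * cost
  exponent< = begin-strict
    e * (p * n)                    <⟨ *-monoʳ-< e (*-monoʳ-< p (≤-reflexive (sum-hardInput k))) ⟩
    e * (p * (2 * 2 ^ suc k))      ≡⟨ solve 3 (λ x y z → x :* (y :* (con 2 :* z)) := x :* y :* con 2 :* z)
                                        refl e p (2 ^ suc k) ⟩
    e * p * 2 * 2 ^ suc k          ≤⟨ *-monoˡ-≤ (2 ^ suc k) 2ep≤1+k ⟩
    suc k * 2 ^ suc k              ≤⟨ shiversCost-hardInput k ⟩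
    cost                           ≤⟨ m≤n*m cost q ⟩
    q * cost                       ∎

theorem6 : (p q : ℕ) → 0 < p → 0 < q → (N : ℕ) →
    Σ (List ℕ) (λ runs →
    All (λ k → 0 < k) runs × N ≤ sum runs × N ≤ length runs ×
    length runs ^ (p * sum runs) < 2 ^ (q * shiversCost runs))
theorem6 p q 0<p 0<q N with linear-beats-log p N
... | k , e , N≤k , 2+k≤2^e , 2ep≤1+k =
  hardInput k , hardInput-positive k , ≤-trans N≤m (length≤sum (hardInput-positive k)) , N≤m ,
  hardInput-cost-beats-log p q {{>-nonZero 0<p}} {{>-nonZero 0<q}} k e 2+k≤2^e 2ep≤1+k
  where
  N≤m : N ≤ length (hardInput k)
  N≤m = ≤-trans (≤-trans N≤k (m≤n+m k 2)) (≤-reflexive (sym (length-hardInput k)))
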